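{- Let $G$ be a connected graph with no subgraph isomorphic to $Y$, and let $C=(u_0u_1\dots u_{k-1})$ be an edge-dominating cycle of $G$ of maximum length among edge-dominating cycles, with $k\ge5$ (indices in $\mathbb{Z}_k$). For $i\in\mathbb{Z}_k$ let $N_i=N_G(u_i)\setminus V(C)$. If $N_i\cap N_j\neq\emptyset$ where $i\neq j$, then $d(i,j)=2$.
   Context: All graphs are finite and simple. $Y$ is the 7-vertex tree obtained from $K_{1,3}$ by subdividing each edge exactly once. A cycle is edge-dominating if every edge of $G$ has at least one endpoint on it. For $i,j\in\mathbb{Z}_k$, $d(i,j)$ is the cyclic distance: $d(i,j)=\min(j-i,k+i-j)$ for $0\le i\le j\le k-1$, and $d(i,j)=d(j,i)$. -}

module Defs where

open import Data.Nat using (ℕ; zero; suc; _≤_; _∸_; _⊓_; ∣_-_∣)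
open import Data.Fin using (Fin; toℕ)
open import Data.Product using (Σ; ∃; _×_; _,_)
open import Data.Sum using (_⊎_)
open import Relation.Nullary using (¬_)
open import Relation.Binary.PropositionalEquality using (_≡_)
open import Function.Definitions using (Injective)

record Graph : Set₁ where
  field
    n      : ℕ
    Adj    : Fin n → Fin n → Set
    sym    : ∀ {x y} → Adj x y → Adj y x
    irrefl : ∀ {x} → ¬ Adj x x

module _ (G : Graph) where
  open Graph G

  V : Set
  V = Fin n

  data Reach : V → V → Set where
    here : ∀ {x} → Reach x x
    step : ∀ {x y z} → Adj x y → Reach y z → Reach x z

  Connected : Set
  Connected = ∀ x y → Reach x y

  -- Y = K_{1,3} with each edge subdivided once: centre 0, middle vertices 1,2,3,
  -- leaves 4,5,6 with edges 0-1,0-2,0-3,1-4,2-5,3-6.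
  -- G contains a subgraph isomorphic to Y iff there is an injective map
  -- Fin 7 → V sending the edges of Y to edges of G.
  HasY : Set
  HasY = Σ (Fin 7 → V) λ f → Injective _≡_ _≡_ f
           × Adj (f (# 0)) (f (# 1)) × Adj (f (# 0)) (f (# 2)) × Adj (f (# 0)) (f (# 3))
           × Adj (f (# 1)) (f (# 4)) × Adj (f (# 2)) (f (# 5)) × Adj (f (# 3)) (f (# 6))
    where open import Data.Fin using (#_)

CycSucc : (k : ℕ) → Fin k → Fin k → Set
CycSucc k i j = (suc (toℕ i) ≡ toℕ j) ⊎ ((suc (toℕ i) ≡ k) × (toℕ j ≡ 0))

cdist : (k : ℕ) → Fin k → Fin k → ℕ
cdist k i j = ∣ toℕ i - toℕ j ∣ ⊓ (k ∸ ∣ toℕ i - toℕ j ∣)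

module _ (G : Graph) where
  open Graph G

  record Cycle : Set where
    field
      len    : ℕ
      len≥3  : 3 ≤ len
      vert   : Fin len → Fin n
      inj    : Injective _≡_ _≡_ vert
      edges  : ∀ i j → CycSucc len i j → Adj (vert i) (vert j)

  OnCycle : Cycle → Fin n → Set
  OnCycle C v = ∃ λ i → Cycle.vert C i ≡ v

  EdgeDominating : Cycle → Set
  EdgeDominating C = ∀ x y → Adj x y → OnCycle C x ⊎ OnCycle C y

  MaxEdgeDominating : Cycle → Set
  MaxEdgeDominating C = EdgeDominating C
    × (∀ (C' : Cycle) → EdgeDominating C' → Cycle.len C' ≤ Cycle.len C)

-- Let s be the offset from i to j along C, so cdist k i j = min(s, k − s). If s or
-- k − s is 1, then u_i and u_j are consecutive and inserting their common neighbour v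
-- between them gives a longer cycle through every vertex of C, still edge-dominating.
-- If s and k − s are both at least 3, then u_i, its two nearest cycle vertices on
-- either side, v and u_j span a Y centred at u_i. Hence s or k − s equals 2.
module Submission where

open import Data.Empty using (⊥-elim)
open import Data.Fin using (Fin; toℕ; zero; suc; fromℕ<; #_)
open import Data.Fin.Properties using (toℕ-fromℕ<; toℕ-injective; toℕ<n)
open import Data.Maybe using (Maybe; just; nothing)
open import Data.Maybe.Relation.Unary.All using (All; just; nothing)
open import Data.Nat using (ℕ; suc; _+_; _*_; _∸_; _⊓_; ∣_-_∣; _≤_; _<_; _≤?_; _≟_; NonZero; z≤n; s≤s; s≤s⁻¹; >-nonZero; ≢-nonZero⁻¹)
open import Data.Nat.DivMod
open import Data.Nat.Divisibility using (_∣_; divides)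
open import Data.Nat.Properties
open import Algebra.Properties.CommutativeSemigroup +-commutativeSemigroup using (x∙yz≈y∙xz)
open import Data.Nat.Tactic.RingSolver using (solve-∀)
open import Data.Product using (∃; ∃-syntax; _×_; _,_)
open import Data.Sum using (inj₁; inj₂) renaming (map to ⊎-map)
open import Function using (_∘_)
open import Function.Definitions using (Injective)
open import Relation.Binary.PropositionalEquality
open import Relation.Nullary using (yes; no; ¬_; contradiction)

open import Defs

module _ {k : ℕ} .{{_ : NonZero k}} where

  %-absorbˡ : ∀ m n → (m % k + n) % k ≡ (m + n) % k
  %-absorbˡ m n = begin
    (m % k + n) % k           ≡⟨ %-distribˡ-+ (m % k) n k ⟩
    (m % k % k + n % k) % k   ≡⟨ cong (λ r → (r + n % k) % k) (m%n%n≡m%n m k) ⟩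
    (m % k + n % k) % k       ≡⟨ %-distribˡ-+ m n k ⟨
    (m + n) % k               ∎
    where open ≡-Reasoning

  %-absorbʳ : ∀ m n → (m + n % k) % k ≡ (m + n) % k
  %-absorbʳ m n = begin
    (m + n % k) % k   ≡⟨ cong (_% k) (+-comm m (n % k)) ⟩
    (n % k + m) % k   ≡⟨ %-absorbˡ n m ⟩
    (n + m) % k       ≡⟨ cong (_% k) (+-comm n m) ⟩
    (m + n) % k       ∎
    where open ≡-Reasoning

  k∣m+[k∸m%k] : ∀ m → k ∣ m + (k ∸ m % k)
  k∣m+[k∸m%k] m = divides (suc (m / k)) (begin
    m + (k ∸ m % k)                     ≡⟨ cong (_+ (k ∸ m % k)) (m≡m%n+[m/n]*n m k) ⟩
    m % k + m / k * k + (k ∸ m % k)     ≡⟨ cong (_+ (k ∸ m % k)) (+-comm (m % k) (m / k * k)) ⟩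
    m / k * k + m % k + (k ∸ m % k)     ≡⟨ +-assoc (m / k * k) (m % k) (k ∸ m % k) ⟩
    m / k * k + (m % k + (k ∸ m % k))   ≡⟨ cong (m / k * k +_) (m+[n∸m]≡n (m%n≤n m k)) ⟩
    m / k * k + k                       ≡⟨ +-comm (m / k * k) k ⟩
    suc (m / k) * k                     ∎)
    where open ≡-Reasoning

  %-unshift : ∀ m s → ((m + s) % k + (k ∸ m % k)) % k ≡ s % k
  %-unshift m s = begin
    ((m + s) % k + (k ∸ m % k)) % k   ≡⟨ %-absorbˡ (m + s) _ ⟩
    (m + s + (k ∸ m % k)) % k         ≡⟨ cong (_% k) (trans (+-assoc m s _) (x∙yz≈y∙xz m s _)) ⟩
    (s + (m + (k ∸ m % k))) % k       ≡⟨ %-remove-+ʳ s (k∣m+[k∸m%k] m) ⟩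
    s % k                             ∎
    where open ≡-Reasoning

  +-%-cancelˡ : ∀ m {s t} → s < k → t < k → (m + s) % k ≡ (m + t) % k → s ≡ t
  +-%-cancelˡ m {s} {t} s<k t<k eq = begin
    s                                  ≡⟨ m<n⇒m%n≡m s<k ⟨
    s % k                              ≡⟨ %-unshift m s ⟨
    ((m + s) % k + (k ∸ m % k)) % k    ≡⟨ cong (λ r → (r + (k ∸ m % k)) % k) eq ⟩
    ((m + t) % k + (k ∸ m % k)) % k    ≡⟨ %-unshift m t ⟩
    t % k                              ≡⟨ m<n⇒m%n≡m t<k ⟩
    t                                  ∎
    where open ≡-Reasoning

  +-%-surjectiveˡ : ∀ m n → ∃[ s ] s < k × (m + s) % k ≡ n % k
  +-%-surjectiveˡ m n = (n + (k ∸ m % k)) % k , m%n<n _ k , (begin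
    (m + (n + (k ∸ m % k)) % k) % k   ≡⟨ %-absorbʳ m _ ⟩
    (m + (n + (k ∸ m % k))) % k       ≡⟨ cong (_% k) (x∙yz≈y∙xz m n _) ⟩
    (n + (m + (k ∸ m % k))) % k       ≡⟨ %-remove-+ʳ n (k∣m+[k∸m%k] m) ⟩
    n % k                             ∎)
    where open ≡-Reasoning

  cyclic-offset : ∀ {x y} → x < k → y < k →
    ∃[ s ] s < k × (x + s) % k ≡ y % k × ∣ x - y ∣ ⊓ (k ∸ ∣ x - y ∣) ≡ s ⊓ (k ∸ s)
  cyclic-offset {x} {y} x<k y<k with x ≤? y
  ... | yes x≤y rewrite m≤n⇒∣m-n∣≡n∸m x≤y =
    y ∸ x , ≤-<-trans (m∸n≤m y x) y<k , cong (_% k) (m+[n∸m]≡n x≤y) , refl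
  ... | no x≰y rewrite m≤n⇒∣n-m∣≡n∸m (<⇒≤ (≰⇒> x≰y)) =
    k ∸ (x ∸ y) , ∸-monoʳ-< (m<n⇒0<n∸m y<x) D≤k , wraps ,
    trans (⊓-comm (x ∸ y) _) (cong ((k ∸ (x ∸ y)) ⊓_) (sym (m∸[m∸n]≡n D≤k)))
    where
    y<x : y < x
    y<x = ≰⇒> x≰y
    D≤k : x ∸ y ≤ k
    D≤k = ≤-trans (m∸n≤m x y) (<⇒≤ x<k)
    wraps : (x + (k ∸ (x ∸ y))) % k ≡ y % k
    wraps = begin
      (x + (k ∸ (x ∸ y))) % k             ≡⟨ cong (λ r → (r + (k ∸ (x ∸ y))) % k) (m+[n∸m]≡n (<⇒≤ y<x)) ⟨
      (y + (x ∸ y) + (k ∸ (x ∸ y))) % k   ≡⟨ cong (_% k) (trans (+-assoc y _ _) (cong (y +_) (m+[n∸m]≡n D≤k))) ⟩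
      (y + k) % k                         ≡⟨ [m+n]%n≡m%n y k ⟩
      y % k                               ∎
      where open ≡-Reasoning

data OffsetClass (k s : ℕ) : Set where
  zero-offset  : s ≡ 0 → OffsetClass k s
  one-forward  : s ≡ 1 → OffsetClass k s
  one-backward : suc s ≡ k → OffsetClass k s
  two-apart    : s ⊓ (k ∸ s) ≡ 2 → OffsetClass k s
  far-apart    : 3 ≤ s → 3 + s ≤ k → OffsetClass k s

offsetClass : ∀ {k s} → 4 ≤ k → s < k → OffsetClass k s
offsetClass {s = 0} _ _ = zero-offset refl
offsetClass {s = 1} _ _ = one-forward refl
offsetClass {s = 2} 4≤k _ = two-apart (m≤n⇒m⊓n≡m (∸-monoˡ-≤ 2 4≤k))
offsetClass {k} {s@(suc (suc (suc _)))} _ s<k with 3 + s ≤? k | suc s ≟ k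
... | yes far | _         = far-apart (s≤s (s≤s (s≤s z≤n))) far
... | no _    | yes s+1≡k = one-backward s+1≡k
... | no ¬far | no s+1≢k  with ≤-antisym (≤∧≢⇒< s<k s+1≢k) (s≤s⁻¹ (≰⇒> ¬far))
...   | refl = two-apart (trans (cong (s ⊓_) (m+n∸n≡m 2 s)) (m≥n⇒m⊓n≡n {s} (s≤s (s≤s z≤n))))

module CyclicIndexing {G : Graph} (C : Cycle G) where
  open Graph G renaming (sym to Adj-sym)
  open Cycle C renaming (len to k)

  instance
    k≢0 : NonZero k
    k≢0 = >-nonZero (≤-trans (s≤s z≤n) len≥3)

  at : ℕ → Fin n
  at m = vert (m mod k)

  toℕ-mod : ∀ m → toℕ (m mod k) ≡ m % k
  toℕ-mod m = toℕ-fromℕ< (m%n<n m k)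

  at-cong : ∀ {m m′} → m % k ≡ m′ % k → at m ≡ at m′
  at-cong {m} {m′} eq = cong vert (toℕ-injective (trans (toℕ-mod m) (trans eq (sym (toℕ-mod m′)))))

  at-toℕ : ∀ i → at (toℕ i) ≡ vert i
  at-toℕ i = cong vert (toℕ-injective (trans (toℕ-mod (toℕ i)) (m<n⇒m%n≡m (toℕ<n i))))

  at-periodic : ∀ m → at (m + k) ≡ at m
  at-periodic m = at-cong ([m+n]%n≡m%n m k)

  at-injective : ∀ {m m′} → at m ≡ at m′ → m % k ≡ m′ % k
  at-injective {m} {m′} eq = trans (sym (toℕ-mod m)) (trans (cong toℕ (inj eq)) (toℕ-mod m′))

  at-shift-injective : ∀ b {s t} → s < k → t < k → at (b + s) ≡ at (b + t) → s ≡ t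
  at-shift-injective b s<k t<k eq = +-%-cancelˡ b s<k t<k (at-injective eq)

  at-onCycle : ∀ m → OnCycle G C (at m)
  at-onCycle m = m mod k , refl

  onCycle⇒at-shift : ∀ b {u} → OnCycle G C u → ∃[ s ] s < k × at (b + s) ≡ u
  onCycle⇒at-shift b (i , refl) with +-%-surjectiveˡ {k} b (toℕ i)
  ... | s , s<k , eq = s , s<k , trans (at-cong eq) (at-toℕ i)

  cycSucc-mod : ∀ m → CycSucc k (m mod k) (suc m mod k)
  cycSucc-mod m with m≤n⇒m<n∨m≡n (m%n<n m k)
  ... | inj₁ 1+m%k<k = inj₁ (begin
    suc (toℕ (m mod k))   ≡⟨ cong suc (toℕ-mod m) ⟩
    suc (m % k)           ≡⟨ m<n⇒m%n≡m 1+m%k<k ⟨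
    suc (m % k) % k       ≡⟨ %-absorbʳ {k} 1 m ⟩
    suc m % k             ≡⟨ toℕ-mod (suc m) ⟨
    toℕ (suc m mod k)     ∎)
    where open ≡-Reasoning
  ... | inj₂ 1+m%k≡k = inj₂ (trans (cong suc (toℕ-mod m)) 1+m%k≡k , (begin
    toℕ (suc m mod k)     ≡⟨ toℕ-mod (suc m) ⟩
    suc m % k             ≡⟨ %-absorbʳ {k} 1 m ⟨
    suc (m % k) % k       ≡⟨ cong (_% k) 1+m%k≡k ⟩
    k % k                 ≡⟨ n%n≡0 k ⟩
    0                     ∎))
    where open ≡-Reasoning

  at-adjacent : ∀ m → Adj (at m) (at (suc m))
  at-adjacent m = edges (m mod k) (suc m mod k) (cycSucc-mod m)

  at-shift-adjacent : ∀ b s → Adj (at (b + s)) (at (b + suc s))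
  at-shift-adjacent b s = subst (λ t → Adj (at (b + s)) (at t)) (sym (+-suc b s)) (at-adjacent (b + s))

  module _ {v : Fin n} (v∉C : ¬ OnCycle G C v) where

    at≢v : ∀ m → at m ≢ v
    at≢v m eq = v∉C (subst (OnCycle G C) eq (at-onCycle m))

    -- The vertices are listed as v, at (suc m), …, at (suc m + (k ∸ 1)) = at m.
    insertAfter : ∀ m → Adj (at m) v → Adj v (at (suc m)) → Cycle G
    insertAfter m mv vm = record
      { len = suc k ; len≥3 = m≤n⇒m≤1+n len≥3 ; vert = w ; inj = w-injective ; edges = w-edges }
      where
      w : Fin (suc k) → Fin n
      w zero    = v
      w (suc p) = at (suc m + toℕ p)

      w-injective : Injective _≡_ _≡_ w
      w-injective {zero}  {zero}  _  = refl
      w-injective {zero}  {suc q} eq = ⊥-elim (at≢v _ (sym eq))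
      w-injective {suc p} {zero}  eq = ⊥-elim (at≢v _ eq)
      w-injective {suc p} {suc q} eq =
        cong suc (toℕ-injective (at-shift-injective (suc m) (toℕ<n p) (toℕ<n q) eq))

      w-edges : ∀ p q → CycSucc (suc k) p q → Adj (w p) (w q)
      w-edges zero    zero    (inj₂ (1≡1+k , _)) = contradiction (suc-injective 1≡1+k) (≢-nonZero⁻¹ k ∘ sym)
      w-edges zero    (suc q) (inj₁ 1≡1+q) =
        subst (λ t → Adj v (at t)) (trans (sym (+-identityʳ (suc m))) (cong (suc m +_) (suc-injective 1≡1+q))) vm
      w-edges (suc p) zero    (inj₂ (2+p≡1+k , _)) = subst (λ u → Adj u v) (sym last≡at-m) mv
        where
        last≡at-m : at (suc m + toℕ p) ≡ at m
        last≡at-m = begin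
          at (suc m + toℕ p)   ≡⟨ cong at (+-suc m (toℕ p)) ⟨
          at (m + suc (toℕ p)) ≡⟨ cong (λ t → at (m + t)) (suc-injective 2+p≡1+k) ⟩
          at (m + k)           ≡⟨ at-periodic m ⟩
          at m                 ∎
          where open ≡-Reasoning
      w-edges (suc p) (suc q) (inj₁ 2+p≡1+q) =
        subst (λ t → Adj (at (suc m + toℕ p)) (at (suc m + t))) (suc-injective 2+p≡1+q)
              (at-shift-adjacent (suc m) (toℕ p))

    onCycle⇒onCycle-insertAfter : ∀ {m} mv vm {u} → OnCycle G C u → OnCycle G (insertAfter m mv vm) u
    onCycle⇒onCycle-insertAfter {m} _ _ u∈C with onCycle⇒at-shift (suc m) u∈C
    ... | s , s<k , eq = suc (fromℕ< s<k) , trans (cong (λ t → at (suc m + t)) (toℕ-fromℕ< s<k)) eq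

    maximum⇒¬insertion : MaxEdgeDominating G C → ∀ m → Adj (at m) v → ¬ Adj v (at (suc m))
    maximum⇒¬insertion (dom , max) m mv vm =
      1+n≰n (max (insertAfter m mv vm) λ x y xy → ⊎-map ⊆-insertAfter ⊆-insertAfter (dom x y xy))
      where
      ⊆-insertAfter : ∀ {u} → OnCycle G C u → OnCycle G (insertAfter m mv vm) u
      ⊆-insertAfter = onCycle⇒onCycle-insertAfter mv vm

    -- Centre at (b + 2), legs at (b + 1) – at b, at (b + 3) – at (b + 4) and v – at (b + (5 + a)).
    spider⇒HasY : ∀ b a → 5 + a < k → Adj (at (b + 2)) v → Adj (at (b + (5 + a))) v → HasY G
    spider⇒HasY b a 5+a<k centre-v far-v =
      point ∘ position , point∘position-injective ,
      Adj-sym (at-shift-adjacent b 1) , at-shift-adjacent b 2 , centre-v ,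
      Adj-sym (at-shift-adjacent b 0) , at-shift-adjacent b 3 , Adj-sym far-v
      where
      position : Fin 7 → Maybe ℕ
      position zero                                     = just 2
      position (suc zero)                               = just 1
      position (suc (suc zero))                         = just 3
      position (suc (suc (suc zero)))                   = nothing
      position (suc (suc (suc (suc zero))))             = just 0
      position (suc (suc (suc (suc (suc zero)))))       = just 4
      position (suc (suc (suc (suc (suc (suc zero)))))) = just (5 + a)

      label : Maybe ℕ → Fin 7
      label nothing  = # 3
      label (just 0) = # 4
      label (just 1) = # 1
      label (just 2) = # 0
      label (just 3) = # 2
      label (just 4) = # 5
      label (just _) = # 6

      label-position : ∀ z → label (position z) ≡ z
      label-position zero                                     = refl
      label-position (suc zero)                               = refl
      label-position (suc (suc zero))                         = refl
      label-position (suc (suc (suc zero)))                   = refl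
      label-position (suc (suc (suc (suc zero))))             = refl
      label-position (suc (suc (suc (suc (suc zero)))))       = refl
      label-position (suc (suc (suc (suc (suc (suc zero)))))) = refl

      position-< : ∀ z → All (_< k) (position z)
      position-< zero                                     = just (≤-<-trans (m≤m+n 2 _) 5+a<k)
      position-< (suc zero)                               = just (≤-<-trans (m≤m+n 1 _) 5+a<k)
      position-< (suc (suc zero))                         = just (≤-<-trans (m≤m+n 3 _) 5+a<k)
      position-< (suc (suc (suc zero)))                   = nothing
      position-< (suc (suc (suc (suc zero))))             = just (≤-<-trans z≤n 5+a<k)
      position-< (suc (suc (suc (suc (suc zero)))))       = just (≤-<-trans (m≤m+n 4 _) 5+a<k)
      position-< (suc (suc (suc (suc (suc (suc zero)))))) = just 5+a<k

      point : Maybe ℕ → Fin n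
      point nothing  = v
      point (just s) = at (b + s)

      point-injective : ∀ {c d} → All (_< k) c → All (_< k) d → point c ≡ point d → c ≡ d
      point-injective nothing    nothing    _  = refl
      point-injective nothing    (just _)   eq = ⊥-elim (at≢v _ (sym eq))
      point-injective (just _)   nothing    eq = ⊥-elim (at≢v _ eq)
      point-injective (just s<k) (just t<k) eq = cong just (at-shift-injective b s<k t<k eq)

      point∘position-injective : Injective _≡_ _≡_ (point ∘ position)
      point∘position-injective {z} {z′} eq = begin
        z                   ≡⟨ label-position z ⟨
        label (position z)  ≡⟨ cong label (point-injective (position-< z) (position-< z′) eq) ⟩
        label (position z′) ≡⟨ label-position z′ ⟩
        z′                  ∎
        where open ≡-Reasoning

    far-neighbours⇒HasY : ∀ {x s} → 3 ≤ s → 3 + s ≤ k → Adj (at x) v → Adj (at (x + s)) v → HasY G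
    far-neighbours⇒HasY {x} 3≤s 3+s≤k xv sv with m≤n⇒∃[o]m+o≡n 3≤s
    ... | a , refl =
      spider⇒HasY (x + (k ∸ 2)) a 3+s≤k
        (subst (λ u → Adj u v) (sym centre≡x) xv) (subst (λ u → Adj u v) (sym far≡x+s) sv)
      where
      k∸2+2≡k : k ∸ 2 + 2 ≡ k
      k∸2+2≡k = m∸n+n≡m (≤-trans (s≤s (s≤s z≤n)) 3+s≤k)

      centre≡x : at (x + (k ∸ 2) + 2) ≡ at x
      centre≡x = trans (cong at (trans (+-assoc x (k ∸ 2) 2) (cong (x +_) k∸2+2≡k))) (at-periodic x)

      rearrange : ∀ x c a → x + c + (5 + a) ≡ x + (3 + a) + (c + 2)
      rearrange = solve-∀

      far≡x+s : at (x + (k ∸ 2) + (5 + a)) ≡ at (x + (3 + a))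
      far≡x+s = trans (cong at (trans (rearrange x (k ∸ 2) a) (cong (x + (3 + a) +_) k∸2+2≡k)))
                      (at-periodic (x + (3 + a)))

    common-neighbour⇒offset≡2 : ¬ HasY G → MaxEdgeDominating G C → 4 ≤ k →
      ∀ {x s} → s ≢ 0 → s < k → Adj (at x) v → Adj (at (x + s)) v → s ⊓ (k ∸ s) ≡ 2
    common-neighbour⇒offset≡2 noY maxC 4≤k {x} {s} s≢0 s<k xv sv with offsetClass 4≤k s<k
    ... | zero-offset s≡0 = contradiction s≡0 s≢0
    ... | one-forward refl =
      ⊥-elim (maximum⇒¬insertion maxC x xv (Adj-sym (subst (λ t → Adj (at t) v) (+-comm x 1) sv)))
    ... | one-backward 1+s≡k =
      ⊥-elim (maximum⇒¬insertion maxC (x + s) sv (subst (Adj v) (sym next≡x) (Adj-sym xv)))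
      where
      next≡x : at (suc (x + s)) ≡ at x
      next≡x = trans (cong at (trans (sym (+-suc x s)) (cong (x +_) 1+s≡k))) (at-periodic x)
    ... | two-apart d = d
    ... | far-apart 3≤s 3+s≤k = ⊥-elim (noY (far-neighbours⇒HasY 3≤s 3+s≤k xv sv))

  common-neighbour⇒cdist≡2 : ¬ HasY G → MaxEdgeDominating G C → 4 ≤ k →
    ∀ {i j v} → i ≢ j → ¬ OnCycle G C v → Adj (vert i) v → Adj (vert j) v → cdist k i j ≡ 2
  common-neighbour⇒cdist≡2 noY maxC 4≤k {i} {j} {v} i≢j v∉C iv jv with cyclic-offset (toℕ<n i) (toℕ<n j)
  ... | s , s<k , i+s≡j , cdist≡ = trans cdist≡
    (common-neighbour⇒offset≡2 v∉C noY maxC 4≤k s≢0 s<k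
      (subst (λ u → Adj u v) (sym (at-toℕ i)) iv) (subst (λ u → Adj u v) (sym at-i+s≡j) jv))
    where
    at-i+s≡j : at (toℕ i + s) ≡ vert j
    at-i+s≡j = trans (at-cong i+s≡j) (at-toℕ j)

    s≢0 : s ≢ 0
    s≢0 refl = i≢j (inj (trans (sym (at-toℕ i)) (trans (cong at (sym (+-identityʳ (toℕ i)))) at-i+s≡j)))

lemma4p5 : (G : Graph) → Connected G → ¬ HasY G
    → (C : Cycle G) → MaxEdgeDominating G C → 5 ≤ Cycle.len C
    → (i j : Fin (Cycle.len C)) → i ≢ j
    → (∃ λ v → ¬ OnCycle G C v
         × Graph.Adj G (Cycle.vert C i) v × Graph.Adj G (Cycle.vert C j) v)
    → cdist (Cycle.len C) i j ≡ 2
lemma4p5 G _ noY C maxC 5≤k i j i≢j (v , v∉C , iv , jv) =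
  common-neighbour⇒cdist≡2 noY maxC (≤-trans (n≤1+n 4) 5≤k) i≢j v∉C iv jv
  where open CyclicIndexing C
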